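{- Let $g(x),f(x)$ be formal power series with integer coefficients and $g(0)=f(0)=1$, let $A=(g(x),xf(x))$ with entries $a_{n,k}=[x^n]g(x)(xf(x))^k$, let $\phi(x)$ be the reversion of $x/f(x)$, let $v(x)=xf(x)$ and let $\bar v$ be the reversion of $v$. Let $c(A;1)$ be the lower-triangular matrix with $(n,k)$ entry $a_{2n,n+k}$. Then $$c(A;1)^{ -1}=\left(\frac{1}{g(\bar v(x))}\,\frac{f(\bar v(x))}{\phi'\!\left(\frac{\bar v(x)}{f(\bar v(x))}\right)},\ \frac{\bar v(x)}{f(\bar v(x))}\right).$$
   Context: A Riordan array $(d(x),h(x))$, for formal power series $d,h$ with $d(0)\neq 0$, $h(0)=0$, $h'(0)\neq 0$, is the infinite lower-triangular matrix whose $(n,k)$ entry is $[x^n]d(x)h(x)^k$. Riordan arrays form a group under matrix multiplication, with $(d,h)\cdot(u,w)=(d(x)u(h(x)),w(h(x)))$ and $(d,h)^{ -1}=(1/d(\bar h),\bar h)$, where $\bar h$ is the reversion of $h$: the power series $u$ with $u(0)=0$ and $h(u(x))=x$. $\phi'$ denotes the derivative of $\phi$. -}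

module Defs where

open import Data.Nat as ℕ using (ℕ; zero; suc; _≡ᵇ_)
open import Data.Bool using (if_then_else_)
open import Data.Integer using (ℤ; +_; 0ℤ; 1ℤ; _+_; _*_)

Series : Set
Series = ℕ → ℤ

Σ≤ : ℕ → (ℕ → ℤ) → ℤ
Σ≤ zero    t = t 0
Σ≤ (suc n) t = Σ≤ n t + t (suc n)

one : Series
one zero    = 1ℤ
one (suc _) = 0ℤ

X : Series
X zero          = 0ℤ
X (suc zero)    = 1ℤ
X (suc (suc _)) = 0ℤ

infixl 7 _⊛_
_⊛_ : Series → Series → Series
(a ⊛ b) n = Σ≤ n (λ i → a i * b (n ℕ.∸ i))

pow : Series → ℕ → Series
pow h zero    = one
pow h (suc k) = h ⊛ pow h k

-- composition d(h(x)); meaningful when h(0) = 0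
-- [x^n] d(h) = Σ_{k ≤ n} d_k [x^n] h^k
infixr 9 _∘ₛ_
_∘ₛ_ : Series → Series → Series
(d ∘ₛ h) n = Σ≤ n (λ k → d k * pow h k n)

deriv : Series → Series
deriv a n = + (suc n) * a (suc n)

Matrix : Set
Matrix = ℕ → ℕ → ℤ

riordan : Series → Series → Matrix
riordan d h n k = (d ⊛ pow h k) n

-- product of lower-triangular infinite matrices: Σ_{j ≤ n} M n j N j k
-- (for lower-triangular M this is the full matrix product)
_·ₘ_ : Matrix → Matrix → Matrix
(M ·ₘ N) n k = Σ≤ n (λ j → M n j * N j k)

idM : Matrix
idM n k = if n ≡ᵇ k then 1ℤ else 0ℤ

cA1 : Series → Series → Matrix
cA1 g f n k = riordan g (X ⊛ f) (n ℕ.+ n) (n ℕ.+ k)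

module Submission where

-- Substituting x ↦ v = x f turns column k of the claimed inverse (d, h) into (1/g) f ψ′ ψ^k
-- with ψ = x/f: indeed h ∘ v = ψ, and 1/φ′(h) becomes ψ′ because φ ∘ ψ = x and the chain rule.
-- By the fundamental theorem of Riordan arrays the (n, k) entry of c(A;1)·(d, h) is then
-- [x^(2n)] g v^n (1/g) f ψ′ ψ^k = [x^(n-k)] f^(n-k+1) ψ′, which is δ_{nk} by the Lagrange
-- identity [x^m] f^(m+1) ψ′ = δ_{m0}, a consequence of f² ψ′ + x f′ = f.  Both matrices are
-- lower triangular and c(A;1) has unit diagonal, so this right inverse is also a left inverse.

open import Defs
open import Algebra.Bundles using (AbelianGroup; CommutativeMonoid)
open import Relation.Binary.Bundles using (Setoid)
import Algebra.Solver.CommutativeMonoid as CommutativeMonoidSolver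
open import Data.Integer using (ℤ; +_; 0ℤ; 1ℤ; _+_; _*_; _-_)
import Data.Integer.Properties as ℤₚ
open import Algebra.Properties.Group (AbelianGroup.group ℤₚ.+-0-abelianGroup)
  using () renaming (∙-cancelˡ to +-cancelˡ; identityˡ-unique to +-identityˡ-unique)
open import Data.Integer.Tactic.RingSolver using (solve-∀)
open import Data.Nat as ℕ using (ℕ; zero; suc; _≤_; _<_; z≤n; s≤s; _∸_)
open import Data.Nat.Induction using (<-rec)
import Data.Nat.Properties as ℕₚ
open import Data.Empty using (⊥-elim)
open import Data.Product using (_×_; _,_)
open import Data.Sum using (_⊎_; inj₁; inj₂)
open import Function using (_∘_)
open import Relation.Binary.PropositionalEquality
open import Relation.Binary.Definitions using (tri<; tri≈; tri>)
import Relation.Binary.Reasoning.Setoid as SetoidReasoning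

module ≗-Reasoning = SetoidReasoning (ℕ →-setoid ℤ)

-- Finite sums

Σ≤-cong : ∀ n {s t : ℕ → ℤ} → (∀ i → i ≤ n → s i ≡ t i) → Σ≤ n s ≡ Σ≤ n t
Σ≤-cong zero    e = e 0 z≤n
Σ≤-cong (suc n) e = cong₂ _+_ (Σ≤-cong n (λ i → e i ∘ ℕₚ.m≤n⇒m≤1+n)) (e (suc n) ℕₚ.≤-refl)

Σ≤-zeros : ∀ n {s : ℕ → ℤ} → (∀ i → i ≤ n → s i ≡ 0ℤ) → Σ≤ n s ≡ 0ℤ
Σ≤-zeros zero    e = e 0 z≤n
Σ≤-zeros (suc n) e = cong₂ _+_ (Σ≤-zeros n (λ i → e i ∘ ℕₚ.m≤n⇒m≤1+n)) (e (suc n) ℕₚ.≤-refl)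

Σ≤-distrib-+ : ∀ n (s t : ℕ → ℤ) → Σ≤ n (λ i → s i + t i) ≡ Σ≤ n s + Σ≤ n t
Σ≤-distrib-+ zero    s t = refl
Σ≤-distrib-+ (suc n) s t rewrite Σ≤-distrib-+ n s t = swap (Σ≤ n s) (Σ≤ n t) (s (suc n)) (t (suc n))
  where swap : ∀ a b c d → a + b + (c + d) ≡ a + c + (b + d)
        swap = solve-∀

Σ≤-distrib-minus : ∀ n (s t : ℕ → ℤ) → Σ≤ n (λ i → s i - t i) ≡ Σ≤ n s - Σ≤ n t
Σ≤-distrib-minus zero    s t = refl
Σ≤-distrib-minus (suc n) s t rewrite Σ≤-distrib-minus n s t = swap (Σ≤ n s) (Σ≤ n t) (s (suc n)) (t (suc n))
  where swap : ∀ a b c d → a - b + (c - d) ≡ a + c - (b + d)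
        swap = solve-∀

*-distribˡ-Σ≤ : ∀ n c (s : ℕ → ℤ) → c * Σ≤ n s ≡ Σ≤ n (λ i → c * s i)
*-distribˡ-Σ≤ zero    c s = refl
*-distribˡ-Σ≤ (suc n) c s =
  trans (ℤₚ.*-distribˡ-+ c (Σ≤ n s) (s (suc n))) (cong (_+ c * s (suc n)) (*-distribˡ-Σ≤ n c s))

*-distribʳ-Σ≤ : ∀ n c (s : ℕ → ℤ) → Σ≤ n s * c ≡ Σ≤ n (λ i → s i * c)
*-distribʳ-Σ≤ zero    c s = refl
*-distribʳ-Σ≤ (suc n) c s =
  trans (ℤₚ.*-distribʳ-+ c (Σ≤ n s) (s (suc n))) (cong (_+ s (suc n) * c) (*-distribʳ-Σ≤ n c s))

Σ≤-head : ∀ n (s : ℕ → ℤ) → Σ≤ (suc n) s ≡ s 0 + Σ≤ n (s ∘ suc)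
Σ≤-head zero    s = refl
Σ≤-head (suc n) s rewrite Σ≤-head n s = ℤₚ.+-assoc (s 0) _ _

Σ≤-comm : ∀ n m (F : ℕ → ℕ → ℤ) → Σ≤ n (λ i → Σ≤ m (F i)) ≡ Σ≤ m (λ j → Σ≤ n (λ i → F i j))
Σ≤-comm zero    m F = refl
Σ≤-comm (suc n) m F rewrite Σ≤-comm n m F = sym (Σ≤-distrib-+ m (λ j → Σ≤ n (λ i → F i j)) (F (suc n)))

Σ≤-truncate : ∀ {m n} {s : ℕ → ℤ} → m ≤ n → (∀ i → m < i → i ≤ n → s i ≡ 0ℤ) → Σ≤ n s ≡ Σ≤ m s
Σ≤-truncate {m} {s = s} m≤n e with ℕₚ.m≤n⇒∃[o]m+o≡n m≤n
... | d , refl = go d e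
  where
    go : ∀ d → (∀ i → m < i → i ≤ m ℕ.+ d → s i ≡ 0ℤ) → Σ≤ (m ℕ.+ d) s ≡ Σ≤ m s
    go zero    e rewrite ℕₚ.+-identityʳ m = refl
    go (suc d) e rewrite ℕₚ.+-suc m d =
      trans (cong₂ _+_ (go d (λ i p q → e i p (ℕₚ.m≤n⇒m≤1+n q)))
                       (e (suc (m ℕ.+ d)) (s≤s (ℕₚ.m≤m+n m d)) ℕₚ.≤-refl))
            (ℤₚ.+-identityʳ _)

Σ≤-single : ∀ n j {s : ℕ → ℤ} → j ≤ n → (∀ i → i ≤ n → i ≢ j → s i ≡ 0ℤ) → Σ≤ n s ≡ s j
Σ≤-single zero    zero p e = refl
Σ≤-single (suc n) j {s} p e with ℕₚ.m≤n⇒m<n∨m≡n p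
... | inj₁ (s≤s j≤n) =
  trans (cong₂ _+_ (Σ≤-single n j j≤n (λ i i≤n → e i (ℕₚ.m≤n⇒m≤1+n i≤n)))
                   (e (suc n) ℕₚ.≤-refl (ℕₚ.>⇒≢ (s≤s j≤n))))
        (ℤₚ.+-identityʳ _)
... | inj₂ refl =
  trans (cong (_+ s (suc n)) (Σ≤-zeros n (λ i i≤n → e i (ℕₚ.m≤n⇒m≤1+n i≤n) (ℕₚ.<⇒≢ (s≤s i≤n)))))
        (ℤₚ.+-identityˡ _)

Σ≤-injective-at : ∀ n j {s t : ℕ → ℤ} → j ≤ n → (∀ i → i ≤ n → i ≢ j → s i ≡ t i) →
                  Σ≤ n s ≡ Σ≤ n t → s j ≡ t j
Σ≤-injective-at n j {s} {t} j≤n agree e = ℤₚ.i-j≡0⇒i≡j (s j) (t j) (begin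
  s j - t j                    ≡⟨ Σ≤-single n j j≤n (λ i i≤n i≢j → ℤₚ.i≡j⇒i-j≡0 (agree i i≤n i≢j)) ⟨
  Σ≤ n (λ i → s i - t i)       ≡⟨ Σ≤-distrib-minus n s t ⟩
  Σ≤ n s - Σ≤ n t              ≡⟨ ℤₚ.i≡j⇒i-j≡0 e ⟩
  0ℤ                           ∎)
  where open ≡-Reasoning

Σ≤-reverse : ∀ n (s : ℕ → ℤ) → Σ≤ n s ≡ Σ≤ n (λ i → s (n ∸ i))
Σ≤-reverse zero    s = refl
Σ≤-reverse (suc n) s = begin
  Σ≤ n s + s (suc n)                      ≡⟨ ℤₚ.+-comm (Σ≤ n s) (s (suc n)) ⟩
  s (suc n) + Σ≤ n s                      ≡⟨ cong (_+_ (s (suc n))) (Σ≤-reverse n s) ⟩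
  s (suc n) + Σ≤ n (λ i → s (n ∸ i))      ≡⟨ Σ≤-head n (λ i → s (suc n ∸ i)) ⟨
  Σ≤ (suc n) (λ i → s (suc n ∸ i))        ∎
  where open ≡-Reasoning

Σ≤-triangle : ∀ n (F : ℕ → ℕ → ℤ) →
              Σ≤ n (λ i → Σ≤ i (F i)) ≡ Σ≤ n (λ j → Σ≤ (n ∸ j) (λ l → F (j ℕ.+ l) j))
Σ≤-triangle zero    F = refl
Σ≤-triangle (suc n) F = begin
  Σ≤ n (λ i → Σ≤ i (F i)) + (Σ≤ n (F (suc n)) + F (suc n) (suc n))
    ≡⟨ cong (_+ (Σ≤ n (F (suc n)) + F (suc n) (suc n))) (Σ≤-triangle n F) ⟩
  Σ≤ n (λ j → Σ≤ (n ∸ j) (G j)) + (Σ≤ n (F (suc n)) + F (suc n) (suc n))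
    ≡⟨ ℤₚ.+-assoc (Σ≤ n (λ j → Σ≤ (n ∸ j) (G j))) (Σ≤ n (F (suc n))) (F (suc n) (suc n)) ⟨
  Σ≤ n (λ j → Σ≤ (n ∸ j) (G j)) + Σ≤ n (F (suc n)) + F (suc n) (suc n)
    ≡⟨ cong (_+ F (suc n) (suc n)) (Σ≤-distrib-+ n (λ j → Σ≤ (n ∸ j) (G j)) (F (suc n))) ⟨
  Σ≤ n (λ j → Σ≤ (n ∸ j) (G j) + F (suc n) j) + F (suc n) (suc n)
    ≡⟨ cong₂ _+_ (Σ≤-cong n extend) (cong (λ k → F k (suc n)) (ℕₚ.+-identityʳ (suc n))) ⟨
  Σ≤ n (λ j → Σ≤ (suc n ∸ j) (G j)) + Σ≤ 0 (G (suc n))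
    ≡⟨ cong (λ k → Σ≤ n (λ j → Σ≤ (suc n ∸ j) (G j)) + Σ≤ k (G (suc n))) (ℕₚ.n∸n≡0 n) ⟨
  Σ≤ (suc n) (λ j → Σ≤ (suc n ∸ j) (G j)) ∎
  where
    open ≡-Reasoning
    G : ℕ → ℕ → ℤ
    G j l = F (j ℕ.+ l) j
    extend : ∀ j → j ≤ n → Σ≤ (suc n ∸ j) (G j) ≡ Σ≤ (n ∸ j) (G j) + F (suc n) j
    extend j j≤n rewrite ℕₚ.+-∸-assoc 1 j≤n =
      cong (λ k → Σ≤ (n ∸ j) (G j) + F k j) (trans (ℕₚ.+-suc j (n ∸ j)) (cong suc (ℕₚ.m+[n∸m]≡n j≤n)))

-- The ring of formal power series

infixl 6 _⊕_
_⊕_ : Series → Series → Series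
(a ⊕ b) n = a n + b n

⊕-cong : ∀ {a a′ b b′} → a ≗ a′ → b ≗ b′ → a ⊕ b ≗ a′ ⊕ b′
⊕-cong ea eb n = cong₂ _+_ (ea n) (eb n)

⊛-cong : ∀ {a a′ b b′} → a ≗ a′ → b ≗ b′ → a ⊛ b ≗ a′ ⊛ b′
⊛-cong ea eb n = Σ≤-cong n (λ i _ → cong₂ _*_ (ea i) (eb (n ∸ i)))

⊛-congˡ : ∀ a {b b′} → b ≗ b′ → a ⊛ b ≗ a ⊛ b′
⊛-congˡ a = ⊛-cong {a} (λ _ → refl)

⊛-congʳ : ∀ {a a′} b → a ≗ a′ → a ⊛ b ≗ a′ ⊛ b
⊛-congʳ b ea = ⊛-cong {b = b} ea (λ _ → refl)

⊛-comm : ∀ a b → a ⊛ b ≗ b ⊛ a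
⊛-comm a b n = trans (Σ≤-reverse n _) (Σ≤-cong n λ i i≤n →
  trans (cong (λ k → a (n ∸ i) * b k) (ℕₚ.m∸[m∸n]≡n i≤n)) (ℤₚ.*-comm (a (n ∸ i)) (b i)))

⊛-identityʳ : ∀ a → a ⊛ one ≗ a
⊛-identityʳ a n = trans (Σ≤-single n n ℕₚ.≤-refl off) (trans (cong (λ k → a n * one k) (ℕₚ.n∸n≡0 n)) (ℤₚ.*-identityʳ (a n)))
  where
    off : ∀ i → i ≤ n → i ≢ n → a i * one (n ∸ i) ≡ 0ℤ
    off i i≤n i≢n with n ∸ i in eq
    ... | zero  = ⊥-elim (i≢n (ℕₚ.≤-antisym i≤n (ℕₚ.m∸n≡0⇒m≤n eq)))
    ... | suc _ = ℤₚ.*-zeroʳ (a i)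

⊛-identityˡ : ∀ a → one ⊛ a ≗ a
⊛-identityˡ a n = trans (⊛-comm one a n) (⊛-identityʳ a n)

⊛-assoc : ∀ a b c → (a ⊛ b) ⊛ c ≗ a ⊛ (b ⊛ c)
⊛-assoc a b c n = begin
  Σ≤ n (λ i → Σ≤ i (λ j → a j * b (i ∸ j)) * c (n ∸ i))
    ≡⟨ Σ≤-cong n (λ i _ → *-distribʳ-Σ≤ i (c (n ∸ i)) _) ⟩
  Σ≤ n (λ i → Σ≤ i (λ j → a j * b (i ∸ j) * c (n ∸ i)))
    ≡⟨ Σ≤-triangle n (λ i j → a j * b (i ∸ j) * c (n ∸ i)) ⟩
  Σ≤ n (λ j → Σ≤ (n ∸ j) (λ l → a j * b (j ℕ.+ l ∸ j) * c (n ∸ (j ℕ.+ l))))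
    ≡⟨ Σ≤-cong n (λ j _ → Σ≤-cong (n ∸ j) (λ l _ → reindex j l)) ⟩
  Σ≤ n (λ j → Σ≤ (n ∸ j) (λ l → a j * (b l * c (n ∸ j ∸ l))))
    ≡⟨ Σ≤-cong n (λ j _ → *-distribˡ-Σ≤ (n ∸ j) (a j) _) ⟨
  Σ≤ n (λ j → a j * Σ≤ (n ∸ j) (λ l → b l * c (n ∸ j ∸ l))) ∎
  where
    open ≡-Reasoning
    reindex : ∀ j l → a j * b (j ℕ.+ l ∸ j) * c (n ∸ (j ℕ.+ l)) ≡ a j * (b l * c (n ∸ j ∸ l))
    reindex j l rewrite ℕₚ.m+n∸m≡n j l | sym (ℕₚ.∸-+-assoc n j l) = ℤₚ.*-assoc (a j) (b l) (c (n ∸ j ∸ l))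

⊛-distribˡ-⊕ : ∀ a b c → a ⊛ (b ⊕ c) ≗ a ⊛ b ⊕ a ⊛ c
⊛-distribˡ-⊕ a b c n = trans (Σ≤-cong n (λ i _ → ℤₚ.*-distribˡ-+ (a i) (b (n ∸ i)) (c (n ∸ i)))) (Σ≤-distrib-+ n _ _)

⊛-commutativeMonoid : CommutativeMonoid _ _
⊛-commutativeMonoid = record
  { Carrier = Series ; _≈_ = _≗_ ; _∙_ = _⊛_ ; ε = one
  ; isCommutativeMonoid = record
    { isMonoid = record
      { isSemigroup = record
        { isMagma = record { isEquivalence = Setoid.isEquivalence (ℕ →-setoid ℤ) ; ∙-cong = ⊛-cong }
        ; assoc = ⊛-assoc }
      ; identity = ⊛-identityˡ , ⊛-identityʳ }
    ; comm = ⊛-comm } }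

open CommutativeMonoidSolver ⊛-commutativeMonoid using (solve; _⊜_) renaming (_⊕_ to _∙_)

⊛-rearrange : ∀ a b c d → (a ⊛ b) ⊛ (c ⊛ d) ≗ (a ⊛ c) ⊛ (b ⊛ d)
⊛-rearrange = solve 4 (λ a b c d → (a ∙ b) ∙ (c ∙ d) ⊜ (a ∙ c) ∙ (b ∙ d)) (λ _ → refl)

X⊛-suc : ∀ a n → (X ⊛ a) (suc n) ≡ a n
X⊛-suc a n = trans (Σ≤-single (suc n) 1 (s≤s z≤n) off) (ℤₚ.*-identityˡ (a n))
  where
    off : ∀ i → i ≤ suc n → i ≢ 1 → X i * a (suc n ∸ i) ≡ 0ℤ
    off zero          _ _   = refl
    off (suc zero)    _ i≢1 = ⊥-elim (i≢1 refl)
    off (suc (suc i)) _ _   = refl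

pow-cong : ∀ {a b} k → a ≗ b → pow a k ≗ pow b k
pow-cong zero    e = λ _ → refl
pow-cong (suc k) e = ⊛-cong e (pow-cong k e)

pow-+ : ∀ a i j → pow a i ⊛ pow a j ≗ pow a (i ℕ.+ j)
pow-+ a zero    j = ⊛-identityˡ (pow a j)
pow-+ a (suc i) j n = trans (⊛-assoc a (pow a i) (pow a j) n) (⊛-congˡ a (pow-+ a i j) n)

pow-⊛ : ∀ a b k → pow (a ⊛ b) k ≗ pow a k ⊛ pow b k
pow-⊛ a b zero    n = sym (⊛-identityˡ one n)
pow-⊛ a b (suc k) n = trans (⊛-congˡ (a ⊛ b) (pow-⊛ a b k) n) (⊛-rearrange a b (pow a k) (pow b k) n)

pow-one : ∀ k → pow one k ≗ one
pow-one zero    n = refl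
pow-one (suc k) n = trans (⊛-identityˡ (pow one k) n) (pow-one k n)

pow-X : ∀ k n → pow X k n ≡ idM k n
pow-X zero    zero    = refl
pow-X zero    (suc n) = refl
pow-X (suc k) zero    = refl
pow-X (suc k) (suc n) = trans (X⊛-suc (pow X k) n) (pow-X k n)

pow-X⊛-shift : ∀ K T m → (pow X K ⊛ T) (K ℕ.+ m) ≡ T m
pow-X⊛-shift zero    T m = ⊛-identityˡ T m
pow-X⊛-shift (suc K) T m = trans (⊛-assoc X (pow X K) T (suc (K ℕ.+ m))) (trans (X⊛-suc (pow X K ⊛ T) (K ℕ.+ m)) (pow-X⊛-shift K T m))

idM-diagonal : ∀ n → idM n n ≡ 1ℤ
idM-diagonal zero    = refl
idM-diagonal (suc n) = idM-diagonal n

idM-offDiagonal : ∀ {n k} → n ≢ k → idM n k ≡ 0ℤ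
idM-offDiagonal {zero}  {zero}  n≢k = ⊥-elim (n≢k refl)
idM-offDiagonal {zero}  {suc k} n≢k = refl
idM-offDiagonal {suc n} {zero}  n≢k = refl
idM-offDiagonal {suc n} {suc k} n≢k = idM-offDiagonal (n≢k ∘ cong suc)

idM-shift : ∀ k m → idM (k ℕ.+ m) k ≡ idM m 0
idM-shift zero    m = refl
idM-shift (suc k) m = idM-shift k m

VanishesBelow : ℕ → Series → Set
VanishesBelow K a = ∀ i → i < K → a i ≡ 0ℤ

vanishesBelow-1 : ∀ {h} → h 0 ≡ 0ℤ → VanishesBelow 1 h
vanishesBelow-1 h0 zero    _           = h0
vanishesBelow-1 h0 (suc i) (s≤s ())

private
  ∸-<-bound : ∀ {K L N i} → K ≤ i → i ≤ N → N < K ℕ.+ L → N ∸ i < L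
  ∸-<-bound {K} {L} {N} {i} K≤i i≤N N<K+L = ℕₚ.+-cancelˡ-< i (N ∸ i) L
    (subst (_< i ℕ.+ L) (sym (ℕₚ.m+[n∸m]≡n i≤N)) (ℕₚ.<-≤-trans N<K+L (ℕₚ.+-monoˡ-≤ L K≤i)))

⊛-vanishesBelow : ∀ {K L a b} → VanishesBelow K a → VanishesBelow L b → VanishesBelow (K ℕ.+ L) (a ⊛ b)
⊛-vanishesBelow {K} {a = a} {b} va vb N N<K+L = Σ≤-zeros N term
  where
    term : ∀ i → i ≤ N → a i * b (N ∸ i) ≡ 0ℤ
    term i i≤N with ℕₚ.<-≤-connex i K
    ... | inj₁ i<K = trans (cong (_* b (N ∸ i)) (va i i<K)) (ℤₚ.*-zeroˡ (b (N ∸ i)))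
    ... | inj₂ K≤i = trans (cong (a i *_) (vb (N ∸ i) (∸-<-bound K≤i i≤N N<K+L))) (ℤₚ.*-zeroʳ (a i))

⊛-leading : ∀ {K L a b} → VanishesBelow K a → VanishesBelow L b → (a ⊛ b) (K ℕ.+ L) ≡ a K * b L
⊛-leading {K} {L} {a} {b} va vb =
  trans (Σ≤-single (K ℕ.+ L) K (ℕₚ.m≤m+n K L) term) (cong (λ l → a K * b l) (ℕₚ.m+n∸m≡n K L))
  where
    term : ∀ i → i ≤ K ℕ.+ L → i ≢ K → a i * b (K ℕ.+ L ∸ i) ≡ 0ℤ
    term i i≤N i≢K with ℕₚ.<-cmp i K
    ... | tri< i<K _ _ = trans (cong (_* b (K ℕ.+ L ∸ i)) (va i i<K)) (ℤₚ.*-zeroˡ (b (K ℕ.+ L ∸ i)))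
    ... | tri≈ _ i≡K _ = ⊥-elim (i≢K i≡K)
    ... | tri> _ _ K<i = trans (cong (a i *_) (vb _ (∸-<-bound K<i i≤N (s≤s ℕₚ.≤-refl)))) (ℤₚ.*-zeroʳ (a i))

pow-vanishesBelow : ∀ h → h 0 ≡ 0ℤ → ∀ k → VanishesBelow k (pow h k)
pow-vanishesBelow h h0 zero    _ ()
pow-vanishesBelow h h0 (suc k) = ⊛-vanishesBelow {a = h} (vanishesBelow-1 h0) (pow-vanishesBelow h h0 k)

pow-diagonal : ∀ h → h 0 ≡ 0ℤ → h 1 ≡ 1ℤ → ∀ k → pow h k k ≡ 1ℤ
pow-diagonal h h0 h1 zero    = refl
pow-diagonal h h0 h1 (suc k) = begin
  (h ⊛ pow h k) (1 ℕ.+ k)  ≡⟨ ⊛-leading {a = h} (vanishesBelow-1 h0) (pow-vanishesBelow h h0 k) ⟩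
  h 1 * pow h k k          ≡⟨ cong₂ _*_ h1 (pow-diagonal h h0 h1 k) ⟩
  1ℤ                       ∎
  where open ≡-Reasoning

-- Composition

riordan-fundamental : ∀ G E v → v 0 ≡ 0ℤ → ∀ N → (G ⊛ (E ∘ₛ v)) N ≡ Σ≤ N (λ j → E j * riordan G v N j)
riordan-fundamental G E v v0 N = begin
  Σ≤ N (λ i → G i * Σ≤ (N ∸ i) (λ j → E j * pow v j (N ∸ i)))
    ≡⟨ Σ≤-cong N (λ i _ → *-distribˡ-Σ≤ (N ∸ i) (G i) _) ⟩
  Σ≤ N (λ i → Σ≤ (N ∸ i) (λ j → G i * (E j * pow v j (N ∸ i))))
    ≡⟨ Σ≤-cong N (λ i _ → Σ≤-truncate (ℕₚ.m∸n≤m N i) (λ j N∸i<j _ → beyond i j N∸i<j)) ⟨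
  Σ≤ N (λ i → Σ≤ N (λ j → G i * (E j * pow v j (N ∸ i))))
    ≡⟨ Σ≤-comm N N _ ⟩
  Σ≤ N (λ j → Σ≤ N (λ i → G i * (E j * pow v j (N ∸ i))))
    ≡⟨ Σ≤-cong N (λ j _ → trans (Σ≤-cong N (λ i _ → swap (G i) (E j) _)) (sym (*-distribˡ-Σ≤ N (E j) _))) ⟩
  Σ≤ N (λ j → E j * Σ≤ N (λ i → G i * pow v j (N ∸ i))) ∎
  where
    open ≡-Reasoning
    swap : ∀ a b c → a * (b * c) ≡ b * (a * c)
    swap = solve-∀
    beyond : ∀ i j → N ∸ i < j → G i * (E j * pow v j (N ∸ i)) ≡ 0ℤ
    beyond i j N∸i<j rewrite pow-vanishesBelow v v0 j (N ∸ i) N∸i<j | ℤₚ.*-zeroʳ (E j) = ℤₚ.*-zeroʳ (G i)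

∘ₛ-cong : ∀ {a a′ b b′} → a ≗ a′ → b ≗ b′ → a ∘ₛ b ≗ a′ ∘ₛ b′
∘ₛ-cong ea eb N = Σ≤-cong N (λ k _ → cong₂ _*_ (ea k) (pow-cong k eb N))

∘ₛ-congˡ : ∀ a {b b′} → b ≗ b′ → a ∘ₛ b ≗ a ∘ₛ b′
∘ₛ-congˡ a = ∘ₛ-cong {a} (λ _ → refl)

∘ₛ-congʳ : ∀ {a a′} b → a ≗ a′ → a ∘ₛ b ≗ a′ ∘ₛ b
∘ₛ-congʳ b ea = ∘ₛ-cong {b = b} ea (λ _ → refl)

∘ₛ-constant : ∀ a b → (a ∘ₛ b) 0 ≡ a 0
∘ₛ-constant a b = ℤₚ.*-identityʳ (a 0)

∘ₛ-distrib-⊛ : ∀ a b v → v 0 ≡ 0ℤ → (a ⊛ b) ∘ₛ v ≗ (a ∘ₛ v) ⊛ (b ∘ₛ v)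
∘ₛ-distrib-⊛ a b v v0 N = begin
  Σ≤ N (λ k → Σ≤ k (λ i → a i * b (k ∸ i)) * pow v k N)
    ≡⟨ Σ≤-cong N (λ k _ → *-distribʳ-Σ≤ k (pow v k N) _) ⟩
  Σ≤ N (λ k → Σ≤ k (λ i → a i * b (k ∸ i) * pow v k N))
    ≡⟨ Σ≤-triangle N _ ⟩
  Σ≤ N (λ i → Σ≤ (N ∸ i) (λ l → a i * b (i ℕ.+ l ∸ i) * pow v (i ℕ.+ l) N))
    ≡⟨ Σ≤-cong N (λ i _ → Σ≤-cong (N ∸ i) (λ l _ → cong (λ u → a i * b u * pow v (i ℕ.+ l) N) (ℕₚ.m+n∸m≡n i l))) ⟩
  Σ≤ N (λ i → Σ≤ (N ∸ i) (λ l → a i * b l * pow v (i ℕ.+ l) N))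
    ≡⟨ Σ≤-cong N (λ i i≤N → Σ≤-truncate (ℕₚ.m∸n≤m N i) (λ l N∸i<l _ → beyond i l i≤N N∸i<l)) ⟨
  Σ≤ N (λ i → Σ≤ N (λ l → a i * b l * pow v (i ℕ.+ l) N))
    ≡⟨ Σ≤-comm N N _ ⟩
  Σ≤ N (λ l → Σ≤ N (λ i → a i * b l * pow v (i ℕ.+ l) N))
    ≡⟨ Σ≤-cong N (λ l _ → trans (Σ≤-cong N (λ i _ → swap l i)) (sym (*-distribˡ-Σ≤ N (b l) _))) ⟩
  Σ≤ N (λ l → b l * Σ≤ N (λ i → a i * (pow v l ⊛ pow v i) N))
    ≡⟨ Σ≤-cong N (λ l _ → cong (b l *_) (sym (riordan-fundamental (pow v l) a v v0 N))) ⟩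
  Σ≤ N (λ l → b l * (pow v l ⊛ (a ∘ₛ v)) N)
    ≡⟨ Σ≤-cong N (λ l _ → cong (b l *_) (⊛-comm (pow v l) (a ∘ₛ v) N)) ⟩
  Σ≤ N (λ l → b l * riordan (a ∘ₛ v) v N l)
    ≡⟨ riordan-fundamental (a ∘ₛ v) b v v0 N ⟨
  ((a ∘ₛ v) ⊛ (b ∘ₛ v)) N ∎
  where
    open ≡-Reasoning
    beyond : ∀ i l → i ≤ N → N ∸ i < l → a i * b l * pow v (i ℕ.+ l) N ≡ 0ℤ
    beyond i l i≤N N∸i<l = trans (cong (a i * b l *_) (pow-vanishesBelow v v0 (i ℕ.+ l) N N<i+l)) (ℤₚ.*-zeroʳ (a i * b l))
      where N<i+l = subst (_< i ℕ.+ l) (ℕₚ.m+[n∸m]≡n i≤N) (ℕₚ.+-monoʳ-< i N∸i<l)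
    swap : ∀ l i → a i * b l * pow v (i ℕ.+ l) N ≡ b l * (a i * (pow v l ⊛ pow v i) N)
    swap l i rewrite pow-+ v l i N | ℕₚ.+-comm i l = reassoc (a i) (b l) (pow v (l ℕ.+ i) N)
      where reassoc : ∀ x y z → x * y * z ≡ y * (x * z)
            reassoc = solve-∀

one-∘ₛ : ∀ v → one ∘ₛ v ≗ one
one-∘ₛ v N = trans (Σ≤-single N 0 z≤n off) (ℤₚ.*-identityˡ (one N))
  where
    off : ∀ i → i ≤ N → i ≢ 0 → one i * pow v i N ≡ 0ℤ
    off zero    _ i≢0 = ⊥-elim (i≢0 refl)
    off (suc i) _ _   = refl

pow-∘ₛ : ∀ b v → v 0 ≡ 0ℤ → ∀ j → pow (b ∘ₛ v) j ≗ pow b j ∘ₛ v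
pow-∘ₛ b v v0 zero    N = sym (one-∘ₛ v N)
pow-∘ₛ b v v0 (suc j) N = trans (⊛-congˡ (b ∘ₛ v) (pow-∘ₛ b v v0 j) N) (sym (∘ₛ-distrib-⊛ b (pow b j) v v0 N))

∘ₛ-assoc : ∀ a b c → b 0 ≡ 0ℤ → c 0 ≡ 0ℤ → (a ∘ₛ b) ∘ₛ c ≗ a ∘ₛ (b ∘ₛ c)
∘ₛ-assoc a b c b0 c0 N = begin
  Σ≤ N (λ k → Σ≤ k (λ j → a j * pow b j k) * pow c k N)
    ≡⟨ Σ≤-cong N (λ k _ → *-distribʳ-Σ≤ k (pow c k N) _) ⟩
  Σ≤ N (λ k → Σ≤ k (λ j → a j * pow b j k * pow c k N))
    ≡⟨ Σ≤-cong N (λ k k≤N → Σ≤-truncate k≤N (λ j k<j _ → beyond k j k<j)) ⟨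
  Σ≤ N (λ k → Σ≤ N (λ j → a j * pow b j k * pow c k N))
    ≡⟨ Σ≤-comm N N _ ⟩
  Σ≤ N (λ j → Σ≤ N (λ k → a j * pow b j k * pow c k N))
    ≡⟨ Σ≤-cong N (λ j _ → trans (Σ≤-cong N (λ k _ → ℤₚ.*-assoc (a j) (pow b j k) (pow c k N))) (sym (*-distribˡ-Σ≤ N (a j) _))) ⟩
  Σ≤ N (λ j → a j * (pow b j ∘ₛ c) N)
    ≡⟨ Σ≤-cong N (λ j _ → cong (a j *_) (pow-∘ₛ b c c0 j N)) ⟨
  Σ≤ N (λ j → a j * pow (b ∘ₛ c) j N) ∎
  where
    open ≡-Reasoning
    beyond : ∀ k j → k < j → a j * pow b j k * pow c k N ≡ 0ℤ
    beyond k j k<j rewrite pow-vanishesBelow b b0 j k k<j | ℤₚ.*-zeroʳ (a j) = refl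

∘ₛ-X : ∀ a → a ∘ₛ X ≗ a
∘ₛ-X a N = trans (Σ≤-single N N ℕₚ.≤-refl off) (trans (cong (a N *_) (trans (pow-X N N) (idM-diagonal N))) (ℤₚ.*-identityʳ (a N)))
  where
    off : ∀ i → i ≤ N → i ≢ N → a i * pow X i N ≡ 0ℤ
    off i _ i≢N rewrite pow-X i N | idM-offDiagonal i≢N = ℤₚ.*-zeroʳ (a i)

X-∘ₛ : ∀ v → v 0 ≡ 0ℤ → X ∘ₛ v ≗ v
X-∘ₛ v v0 zero    = sym v0
X-∘ₛ v v0 (suc N) = trans (Σ≤-single (suc N) 1 (s≤s z≤n) off) (trans (ℤₚ.*-identityˡ _) (⊛-identityʳ v (suc N)))
  where
    off : ∀ i → i ≤ suc N → i ≢ 1 → X i * pow v i (suc N) ≡ 0ℤ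
    off zero          _ _   = refl
    off (suc zero)    _ i≢1 = ⊥-elim (i≢1 refl)
    off (suc (suc i)) _ _   = refl

-- Compositional inverses

pow-agree : ∀ {u u′ m} → (∀ i → i < m → u i ≡ u′ i) → ∀ k l → l < m → pow u k l ≡ pow u′ k l
pow-agree e zero    l l<m = refl
pow-agree e (suc k) l l<m = Σ≤-cong l λ i i≤l →
  cong₂ _*_ (e i (ℕₚ.≤-<-trans i≤l l<m)) (pow-agree e k (l ∸ i) (ℕₚ.≤-<-trans (ℕₚ.m∸n≤m l i) l<m))

pow-agree-nonlinear : ∀ {u u′ m} → u 0 ≡ 0ℤ → u′ 0 ≡ 0ℤ → (∀ i → i < m → u i ≡ u′ i) →
                      ∀ j → pow u (2 ℕ.+ j) m ≡ pow u′ (2 ℕ.+ j) m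
pow-agree-nonlinear {u} {u′} {m} u0 u′0 e j = Σ≤-cong m term
  where
    term : ∀ i → i ≤ m → u i * pow u (suc j) (m ∸ i) ≡ u′ i * pow u′ (suc j) (m ∸ i)
    term zero    _ rewrite u0 | u′0 = refl
    term (suc i) i<m+1 with ℕₚ.m≤n⇒m<n∨m≡n i<m+1
    ... | inj₁ i<m = cong₂ _*_ (e (suc i) i<m) (pow-agree e (suc j) (m ∸ suc i) (ℕₚ.∸-monoʳ-< (s≤s z≤n) i<m+1))
    ... | inj₂ refl rewrite ℕₚ.n∸n≡0 i
                          | pow-vanishesBelow u u0 (suc j) 0 (s≤s z≤n)
                          | pow-vanishesBelow u′ u′0 (suc j) 0 (s≤s z≤n)
                          | ℤₚ.*-zeroʳ (u (suc i)) | ℤₚ.*-zeroʳ (u′ (suc i)) = refl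

∘ₛ-cancelˡ : ∀ a {u u′} → a 1 ≡ 1ℤ → u 0 ≡ 0ℤ → u′ 0 ≡ 0ℤ → a ∘ₛ u ≗ a ∘ₛ u′ → u ≗ u′
∘ₛ-cancelˡ a {u} {u′} a1 u0 u′0 e = <-rec (λ m → u m ≡ u′ m) step
  where
    linear : ∀ v M → v M ≡ a 1 * pow v 1 M
    linear v M = sym (trans (cong (_* pow v 1 M) a1) (trans (ℤₚ.*-identityˡ _) (⊛-identityʳ v M)))
    step : ∀ m → (∀ {i} → i < m → u i ≡ u′ i) → u m ≡ u′ m
    step zero    _  = trans u0 (sym u′0)
    step (suc m) ih = begin
      u (suc m)                 ≡⟨ linear u (suc m) ⟩
      a 1 * pow u 1 (suc m)     ≡⟨ Σ≤-injective-at (suc m) 1 (s≤s z≤n) agree (e (suc m)) ⟩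
      a 1 * pow u′ 1 (suc m)    ≡⟨ linear u′ (suc m) ⟨
      u′ (suc m)                ∎
      where
        open ≡-Reasoning
        agree : ∀ k → k ≤ suc m → k ≢ 1 → a k * pow u k (suc m) ≡ a k * pow u′ k (suc m)
        agree zero          _ _   = refl
        agree (suc zero)    _ k≢1 = ⊥-elim (k≢1 refl)
        agree (suc (suc j)) _ _   = cong (a (2 ℕ.+ j) *_) (pow-agree-nonlinear u0 u′0 (λ i → ih) j)

∘ₛ-inverseʳ⇒inverseˡ : ∀ a b → a 0 ≡ 0ℤ → a 1 ≡ 1ℤ → b 0 ≡ 0ℤ → a ∘ₛ b ≗ X → b ∘ₛ a ≗ X
∘ₛ-inverseʳ⇒inverseˡ a b a0 a1 b0 ab = ∘ₛ-cancelˡ a a1 (trans (∘ₛ-constant b a) b0) refl (begin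
  a ∘ₛ (b ∘ₛ a)  ≈⟨ ∘ₛ-assoc a b a b0 a0 ⟨
  (a ∘ₛ b) ∘ₛ a  ≈⟨ ∘ₛ-congʳ a ab ⟩
  X ∘ₛ a         ≈⟨ X-∘ₛ a a0 ⟩
  a              ≈⟨ ∘ₛ-X a ⟨
  a ∘ₛ X         ∎)
  where open ≗-Reasoning

-- Formal derivatives

infixr 7 _·ₛ_
_·ₛ_ : ℤ → Series → Series
(c ·ₛ a) n = c * a n

⊛-·ₛ : ∀ c a b → a ⊛ (c ·ₛ b) ≗ c ·ₛ (a ⊛ b)
⊛-·ₛ c a b n = trans (Σ≤-cong n (λ i _ → swap (a i) c (b (n ∸ i)))) (sym (*-distribˡ-Σ≤ n c _))
  where swap : ∀ x c y → x * (c * y) ≡ c * (x * y)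
        swap = solve-∀

deriv-cong : ∀ {a b} → a ≗ b → deriv a ≗ deriv b
deriv-cong e n = cong (+ suc n *_) (e (suc n))

deriv-X : deriv X ≗ one
deriv-X zero    = refl
deriv-X (suc n) = ℤₚ.*-zeroʳ (+ suc (suc n))

deriv-⊛ : ∀ a b → deriv (a ⊛ b) ≗ deriv a ⊛ b ⊕ a ⊛ deriv b
deriv-⊛ a b n = begin
  + suc n * Σ≤ (suc n) (λ i → a i * b (suc n ∸ i))
    ≡⟨ *-distribˡ-Σ≤ (suc n) (+ suc n) _ ⟩
  Σ≤ (suc n) (λ i → + suc n * (a i * b (suc n ∸ i)))
    ≡⟨ Σ≤-cong (suc n) (λ i i≤n+1 → split i i≤n+1) ⟩
  Σ≤ (suc n) (λ i → + i * (a i * b (suc n ∸ i)) + + (suc n ∸ i) * (a i * b (suc n ∸ i)))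
    ≡⟨ Σ≤-distrib-+ (suc n) _ _ ⟩
  Σ≤ (suc n) (λ i → + i * (a i * b (suc n ∸ i))) + Σ≤ (suc n) (λ i → + (suc n ∸ i) * (a i * b (suc n ∸ i)))
    ≡⟨ cong₂ _+_ left right ⟩
  (deriv a ⊛ b) n + (a ⊛ deriv b) n ∎
  where
    open ≡-Reasoning
    split : ∀ i → i ≤ suc n → + suc n * (a i * b (suc n ∸ i)) ≡ + i * (a i * b (suc n ∸ i)) + + (suc n ∸ i) * (a i * b (suc n ∸ i))
    split i i≤n+1 = trans (cong (λ m → + m * (a i * b (suc n ∸ i))) (sym (ℕₚ.m+[n∸m]≡n i≤n+1)))
                          (trans (cong (_* (a i * b (suc n ∸ i))) (ℤₚ.pos-+ i (suc n ∸ i)))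
                                 (ℤₚ.*-distribʳ-+ (a i * b (suc n ∸ i)) (+ i) (+ (suc n ∸ i))))
    reassocˡ : ∀ c x y → c * (x * y) ≡ c * x * y
    reassocˡ = solve-∀
    reassocʳ : ∀ c x y → c * (x * y) ≡ x * (c * y)
    reassocʳ = solve-∀
    left : Σ≤ (suc n) (λ i → + i * (a i * b (suc n ∸ i))) ≡ (deriv a ⊛ b) n
    left = trans (Σ≤-head n _) (trans (ℤₚ.+-identityˡ _) (Σ≤-cong n (λ i _ → reassocˡ (+ suc i) (a (suc i)) (b (n ∸ i)))))
    right : Σ≤ (suc n) (λ i → + (suc n ∸ i) * (a i * b (suc n ∸ i))) ≡ (a ⊛ deriv b) n
    right rewrite ℕₚ.n∸n≡0 n = trans (ℤₚ.+-identityʳ _) (Σ≤-cong n λ i i≤n →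
      trans (cong (λ k → + k * (a i * b k)) (ℕₚ.+-∸-assoc 1 i≤n)) (reassocʳ (+ suc (n ∸ i)) (a i) (b (suc (n ∸ i)))))

deriv-pow : ∀ b k → deriv (pow b (suc k)) ≗ + suc k ·ₛ (pow b k ⊛ deriv b)
deriv-pow b zero    n = trans (deriv-cong (⊛-identityʳ b) n) (sym (trans (ℤₚ.*-identityˡ _) (⊛-identityˡ (deriv b) n)))
deriv-pow b (suc k) n = begin
  deriv (b ⊛ pow b (suc k)) n
    ≡⟨ deriv-⊛ b (pow b (suc k)) n ⟩
  (deriv b ⊛ pow b (suc k)) n + (b ⊛ deriv (pow b (suc k))) n
    ≡⟨ cong₂ _+_ (⊛-comm (deriv b) (pow b (suc k)) n)
                 (trans (⊛-congˡ b (deriv-pow b k) n) (⊛-·ₛ (+ suc k) b (pow b k ⊛ deriv b) n)) ⟩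
  (pow b (suc k) ⊛ deriv b) n + + suc k * (b ⊛ (pow b k ⊛ deriv b)) n
    ≡⟨ cong (λ z → (pow b (suc k) ⊛ deriv b) n + + suc k * z) (⊛-assoc b (pow b k) (deriv b) n) ⟨
  (pow b (suc k) ⊛ deriv b) n + + suc k * (pow b (suc k) ⊛ deriv b) n
    ≡⟨ collect ((pow b (suc k) ⊛ deriv b) n) (+ suc k) ⟩
  (1ℤ + + suc k) * (pow b (suc k) ⊛ deriv b) n ∎
  where
    open ≡-Reasoning
    collect : ∀ x c → x + c * x ≡ (1ℤ + c) * x
    collect = solve-∀

deriv-∘ₛ : ∀ a v → v 0 ≡ 0ℤ → deriv (a ∘ₛ v) ≗ (deriv a ∘ₛ v) ⊛ deriv v
deriv-∘ₛ a v v0 n = begin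
  + suc n * Σ≤ (suc n) (λ k → a k * pow v k (suc n))
    ≡⟨ *-distribˡ-Σ≤ (suc n) (+ suc n) _ ⟩
  Σ≤ (suc n) (λ k → + suc n * (a k * pow v k (suc n)))
    ≡⟨ Σ≤-head n _ ⟩
  + suc n * (a 0 * one (suc n)) + Σ≤ n (λ j → + suc n * (a (suc j) * pow v (suc j) (suc n)))
    ≡⟨ cong (_+ Σ≤ n (λ j → + suc n * (a (suc j) * pow v (suc j) (suc n)))) constant-term ⟩
  0ℤ + Σ≤ n (λ j → + suc n * (a (suc j) * pow v (suc j) (suc n)))
    ≡⟨ ℤₚ.+-identityˡ _ ⟩
  Σ≤ n (λ j → + suc n * (a (suc j) * pow v (suc j) (suc n)))
    ≡⟨ Σ≤-cong n (λ j _ → trans (reassocʳ (+ suc n) (a (suc j)) (pow v (suc j) (suc n)))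
                                 (cong (a (suc j) *_) (trans (deriv-pow v j n) (cong (+ suc j *_) (⊛-comm (pow v j) (deriv v) n))))) ⟩
  Σ≤ n (λ j → a (suc j) * (+ suc j * (deriv v ⊛ pow v j) n))
    ≡⟨ Σ≤-cong n (λ j _ → reassocˡ (a (suc j)) (+ suc j) ((deriv v ⊛ pow v j) n)) ⟩
  Σ≤ n (λ j → deriv a j * riordan (deriv v) v n j)
    ≡⟨ riordan-fundamental (deriv v) (deriv a) v v0 n ⟨
  (deriv v ⊛ (deriv a ∘ₛ v)) n
    ≡⟨ ⊛-comm (deriv v) (deriv a ∘ₛ v) n ⟩
  ((deriv a ∘ₛ v) ⊛ deriv v) n ∎
  where
    open ≡-Reasoning
    constant-term : + suc n * (a 0 * one (suc n)) ≡ 0ℤ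
    constant-term = trans (cong (+ suc n *_) (ℤₚ.*-zeroʳ (a 0))) (ℤₚ.*-zeroʳ (+ suc n))
    reassocʳ : ∀ c x y → c * (x * y) ≡ x * (c * y)
    reassocʳ = solve-∀
    reassocˡ : ∀ x c y → x * (c * y) ≡ c * x * y
    reassocˡ = solve-∀

-- Lagrange inversion

⊛-inverse-unique : ∀ a b c → a ⊛ b ≗ one → a ⊛ c ≗ one → b ≗ c
⊛-inverse-unique a b c ab≗1 ac≗1 = begin
  b              ≈⟨ ⊛-identityʳ b ⟨
  b ⊛ one        ≈⟨ ⊛-congˡ b ac≗1 ⟨
  b ⊛ (a ⊛ c)    ≈⟨ ⊛-assoc b a c ⟨
  (b ⊛ a) ⊛ c    ≈⟨ ⊛-congʳ c (λ n → trans (⊛-comm b a n) (ab≗1 n)) ⟩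
  one ⊛ c        ≈⟨ ⊛-identityˡ c ⟩
  c              ∎
  where open ≗-Reasoning

⊛-inverse-constant : ∀ a b → a 0 ≡ 1ℤ → a ⊛ b ≗ one → b 0 ≡ 1ℤ
⊛-inverse-constant a b a0 ab≗1 = trans (sym (ℤₚ.*-identityˡ (b 0))) (trans (cong (_* b 0) (sym a0)) (ab≗1 0))

module _ (f finv : Series) (f0 : f 0 ≡ 1ℤ) (f⊛finv : f ⊛ finv ≗ one) where

  private
    ψ ψ′ : Series
    ψ  = X ⊛ finv
    ψ′ = deriv ψ

  f²⊛ψ′⊕X⊛f′≗f : f ⊛ f ⊛ ψ′ ⊕ X ⊛ deriv f ≗ f
  f²⊛ψ′⊕X⊛f′≗f = begin
    f ⊛ f ⊛ ψ′ ⊕ X ⊛ deriv f                ≈⟨ ⊕-cong (⊛-assoc f f ψ′) (⊛-congʳ (deriv f) (sym ∘ f⊛ψ≗X)) ⟩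
    f ⊛ (f ⊛ ψ′) ⊕ (f ⊛ ψ) ⊛ deriv f        ≈⟨ (λ n → ℤₚ.+-comm ((f ⊛ (f ⊛ ψ′)) n) (((f ⊛ ψ) ⊛ deriv f) n)) ⟩
    (f ⊛ ψ) ⊛ deriv f ⊕ f ⊛ (f ⊛ ψ′)        ≈⟨ ⊕-cong (regroup f ψ (deriv f)) (λ _ → refl) ⟩
    f ⊛ (deriv f ⊛ ψ) ⊕ f ⊛ (f ⊛ ψ′)        ≈⟨ ⊛-distribˡ-⊕ f (deriv f ⊛ ψ) (f ⊛ ψ′) ⟨
    f ⊛ (deriv f ⊛ ψ ⊕ f ⊛ ψ′)              ≈⟨ ⊛-congˡ f (deriv-⊛ f ψ) ⟨
    f ⊛ deriv (f ⊛ ψ)                       ≈⟨ ⊛-congˡ f (deriv-cong f⊛ψ≗X) ⟩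
    f ⊛ deriv X                             ≈⟨ ⊛-congˡ f deriv-X ⟩
    f ⊛ one                                 ≈⟨ ⊛-identityʳ f ⟩
    f                                       ∎
    where
      open ≗-Reasoning
      regroup : ∀ a b c → (a ⊛ b) ⊛ c ≗ a ⊛ (c ⊛ b)
      regroup = solve 3 (λ a b c → (a ∙ b) ∙ c ⊜ a ∙ (c ∙ b)) (λ _ → refl)
      f⊛ψ≗X : f ⊛ ψ ≗ X
      f⊛ψ≗X = begin
        f ⊛ (X ⊛ finv)   ≈⟨ solve 3 (λ a b c → a ∙ (b ∙ c) ⊜ b ∙ (a ∙ c)) (λ _ → refl) f X finv ⟩
        X ⊛ (f ⊛ finv)   ≈⟨ ⊛-congˡ X f⊛finv ⟩
        X ⊛ one          ≈⟨ ⊛-identityʳ X ⟩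
        X                ∎

  pow⊛ψ′-coeff : ∀ m → (pow f (suc m) ⊛ ψ′) m ≡ idM m 0
  pow⊛ψ′-coeff zero = cong₂ _*_ (trans (⊛-identityʳ f 0) f0)
                                (trans (ℤₚ.*-identityˡ _) (trans (X⊛-suc finv 0) (⊛-inverse-constant f finv f0 f⊛finv)))
  pow⊛ψ′-coeff (suc m) = +-identityˡ-unique _ (pow f (suc m) (suc m)) (begin
    (f ⊛ (f ⊛ F) ⊛ ψ′) (suc m) + pow f (suc m) (suc m)
      ≡⟨ cong₂ _+_ (regroup F f ψ′ (suc m)) (sym F⊛X⊛f′≡f^[m+1]) ⟩
    (F ⊛ (f ⊛ f ⊛ ψ′)) (suc m) + (F ⊛ (X ⊛ deriv f)) (suc m)
      ≡⟨ ⊛-distribˡ-⊕ F (f ⊛ f ⊛ ψ′) (X ⊛ deriv f) (suc m) ⟨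
    (F ⊛ (f ⊛ f ⊛ ψ′ ⊕ X ⊛ deriv f)) (suc m)
      ≡⟨ ⊛-congˡ F f²⊛ψ′⊕X⊛f′≗f (suc m) ⟩
    (F ⊛ f) (suc m)
      ≡⟨ ⊛-comm F f (suc m) ⟩
    pow f (suc m) (suc m) ∎)
    where
      open ≡-Reasoning
      F : Series
      F = pow f m
      regroup : ∀ a b c → b ⊛ (b ⊛ a) ⊛ c ≗ a ⊛ (b ⊛ b ⊛ c)
      regroup = solve 3 (λ a b c → (b ∙ (b ∙ a)) ∙ c ⊜ a ∙ ((b ∙ b) ∙ c)) (λ _ → refl)
      -- [x^m] f^m f′ = [x^m] (f^{m+1})′ / (m+1)
      F⊛X⊛f′≡f^[m+1] : (F ⊛ (X ⊛ deriv f)) (suc m) ≡ pow f (suc m) (suc m)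
      F⊛X⊛f′≡f^[m+1] = begin
        (F ⊛ (X ⊛ deriv f)) (suc m)  ≡⟨ ⊛-comm F (X ⊛ deriv f) (suc m) ⟩
        ((X ⊛ deriv f) ⊛ F) (suc m)  ≡⟨ ⊛-assoc X (deriv f) F (suc m) ⟩
        (X ⊛ (deriv f ⊛ F)) (suc m)  ≡⟨ X⊛-suc (deriv f ⊛ F) m ⟩
        (deriv f ⊛ F) m              ≡⟨ ⊛-comm (deriv f) F m ⟩
        (F ⊛ deriv f) m              ≡⟨ ℤₚ.*-cancelˡ-≡ (+ suc m) _ _ (sym (deriv-pow f m m)) ⟩
        pow f (suc m) (suc m)        ∎

-- Lower-triangular matrices

LowerTriangular : Matrix → Set
LowerTriangular M = ∀ {n k} → n < k → M n k ≡ 0ℤ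

·ₘ-identityˡ : ∀ M n k → (idM ·ₘ M) n k ≡ M n k
·ₘ-identityˡ M n k = trans (Σ≤-single n n ℕₚ.≤-refl off) (trans (cong (_* M n k) (idM-diagonal n)) (ℤₚ.*-identityˡ (M n k)))
  where
    off : ∀ j → j ≤ n → j ≢ n → idM n j * M j k ≡ 0ℤ
    off j _ j≢n = trans (cong (_* M j k) (idM-offDiagonal (j≢n ∘ sym))) (ℤₚ.*-zeroˡ (M j k))

·ₘ-identityʳ : ∀ {M} → LowerTriangular M → ∀ n k → (M ·ₘ idM) n k ≡ M n k
·ₘ-identityʳ {M} M-low n k with ℕₚ.≤-<-connex k n
... | inj₁ k≤n = trans (Σ≤-single n k k≤n off) (trans (cong (M n k *_) (idM-diagonal k)) (ℤₚ.*-identityʳ (M n k)))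
  where
    off : ∀ j → j ≤ n → j ≢ k → M n j * idM j k ≡ 0ℤ
    off j _ j≢k = trans (cong (M n j *_) (idM-offDiagonal j≢k)) (ℤₚ.*-zeroʳ (M n j))
... | inj₂ n<k = trans (Σ≤-zeros n off) (sym (M-low n<k))
  where
    off : ∀ j → j ≤ n → M n j * idM j k ≡ 0ℤ
    off j j≤n = trans (cong (M n j *_) (idM-offDiagonal (ℕₚ.<⇒≢ (ℕₚ.≤-<-trans j≤n n<k)))) (ℤₚ.*-zeroʳ (M n j))

·ₘ-assoc : ∀ A {B} C → LowerTriangular B → ∀ n k → ((A ·ₘ B) ·ₘ C) n k ≡ (A ·ₘ (B ·ₘ C)) n k
·ₘ-assoc A {B} C B-low n k = begin
  Σ≤ n (λ j → Σ≤ n (λ i → A n i * B i j) * C j k)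
    ≡⟨ Σ≤-cong n (λ j _ → *-distribʳ-Σ≤ n (C j k) _) ⟩
  Σ≤ n (λ j → Σ≤ n (λ i → A n i * B i j * C j k))
    ≡⟨ Σ≤-comm n n _ ⟩
  Σ≤ n (λ i → Σ≤ n (λ j → A n i * B i j * C j k))
    ≡⟨ Σ≤-cong n (λ i i≤n → Σ≤-truncate i≤n (λ j i<j _ → above i j i<j)) ⟩
  Σ≤ n (λ i → Σ≤ i (λ j → A n i * B i j * C j k))
    ≡⟨ Σ≤-cong n (λ i _ → trans (Σ≤-cong i (λ j _ → ℤₚ.*-assoc (A n i) (B i j) (C j k))) (sym (*-distribˡ-Σ≤ i (A n i) _))) ⟩
  Σ≤ n (λ i → A n i * Σ≤ i (λ j → B i j * C j k)) ∎
  where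
    open ≡-Reasoning
    above : ∀ i j → i < j → A n i * B i j * C j k ≡ 0ℤ
    above i j i<j rewrite B-low i<j | ℤₚ.*-zeroʳ (A n i) = ℤₚ.*-zeroˡ (C j k)

unitriangular-cancelˡ : ∀ {C M N} → (∀ n → C n n ≡ 1ℤ) →
                        (∀ n k → (C ·ₘ M) n k ≡ (C ·ₘ N) n k) → ∀ n k → M n k ≡ N n k
unitriangular-cancelˡ {C} {M} {N} C-diag CM≡CN = <-rec (λ n → ∀ k → M n k ≡ N n k) step
  where
    cancel-diagonal : ∀ n k → C n n * M n k ≡ C n n * N n k → M n k ≡ N n k
    cancel-diagonal n k e rewrite C-diag n = trans (sym (ℤₚ.*-identityˡ (M n k))) (trans e (ℤₚ.*-identityˡ (N n k)))
    step : ∀ n → (∀ {j} → j < n → ∀ k → M j k ≡ N j k) → ∀ k → M n k ≡ N n k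
    step zero    _  k = cancel-diagonal 0 k (CM≡CN 0 k)
    step (suc n) ih k = cancel-diagonal (suc n) k (+-cancelˡ (Σ≤ n (λ j → C (suc n) j * M j k)) _ _
      (trans (CM≡CN (suc n) k)
             (cong (_+ C (suc n) (suc n) * N (suc n) k) (Σ≤-cong n (λ j j≤n → cong (C (suc n) j *_) (sym (ih (s≤s j≤n) k)))))))

inverseʳ⇒inverseˡ : ∀ {C R} → LowerTriangular C → LowerTriangular R → (∀ n → C n n ≡ 1ℤ) →
                    (∀ n k → (C ·ₘ R) n k ≡ idM n k) → ∀ n k → (R ·ₘ C) n k ≡ idM n k
inverseʳ⇒inverseˡ {C} {R} C-low R-low C-diag CR≡I = unitriangular-cancelˡ {C} {R ·ₘ C} {idM} C-diag λ n k → begin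
  (C ·ₘ (R ·ₘ C)) n k   ≡⟨ ·ₘ-assoc C C R-low n k ⟨
  ((C ·ₘ R) ·ₘ C) n k   ≡⟨ Σ≤-cong n (λ j _ → cong (_* C j k) (CR≡I n j)) ⟩
  (idM ·ₘ C) n k        ≡⟨ ·ₘ-identityˡ C n k ⟩
  C n k                 ≡⟨ ·ₘ-identityʳ C-low n k ⟨
  (C ·ₘ idM) n k        ∎
  where open ≡-Reasoning

-- Riordan arrays

pow-X⊛-below : ∀ K T N → N < K → (pow X K ⊛ T) N ≡ 0ℤ
pow-X⊛-below K T N N<K = trans (⊛-comm (pow X K) T N) (⊛-vanishesBelow {0} {K} {T} (λ _ ()) (pow-vanishesBelow X refl K) N N<K)

riordan-lowerTriangular : ∀ d {h} → h 0 ≡ 0ℤ → LowerTriangular (riordan d h)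
riordan-lowerTriangular d {h} h0 {n} {k} = ⊛-vanishesBelow {0} {k} {d} (λ _ ()) (pow-vanishesBelow h h0 k) n

riordan-diagonal : ∀ d h → d 0 ≡ 1ℤ → h 0 ≡ 0ℤ → h 1 ≡ 1ℤ → ∀ n → riordan d h n n ≡ 1ℤ
riordan-diagonal d h d0 h0 h1 n = begin
  (d ⊛ pow h n) (0 ℕ.+ n)  ≡⟨ ⊛-leading {0} {n} {d} (λ _ ()) (pow-vanishesBelow h h0 n) ⟩
  d 0 * pow h n n          ≡⟨ cong₂ _*_ d0 (pow-diagonal h h0 h1 n) ⟩
  1ℤ                       ∎
  where open ≡-Reasoning

module _ (g f : Series) where

  private
    v : Series
    v = X ⊛ f

  cA1-lowerTriangular : LowerTriangular (cA1 g f)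
  cA1-lowerTriangular {n} n<k = riordan-lowerTriangular g refl (ℕₚ.+-monoʳ-< n n<k)

  cA1-diagonal : g 0 ≡ 1ℤ → f 0 ≡ 1ℤ → ∀ n → cA1 g f n n ≡ 1ℤ
  cA1-diagonal g0 f0 n = riordan-diagonal g v g0 refl (trans (X⊛-suc f 0) f0) (n ℕ.+ n)

  cA1-·ₘ-riordan : ∀ E h n k → (cA1 g f ·ₘ riordan E h) n k ≡ ((g ⊛ pow v n) ⊛ ((E ⊛ pow h k) ∘ₛ v)) (n ℕ.+ n)
  cA1-·ₘ-riordan E h n k = sym (begin
    ((g ⊛ pow v n) ⊛ (Eₖ ∘ₛ v)) (n ℕ.+ n)
      ≡⟨ riordan-fundamental (g ⊛ pow v n) Eₖ v refl (n ℕ.+ n) ⟩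
    Σ≤ (n ℕ.+ n) (λ j → Eₖ j * ((g ⊛ pow v n) ⊛ pow v j) (n ℕ.+ n))
      ≡⟨ Σ≤-cong (n ℕ.+ n) (λ j _ → cong (Eₖ j *_) (entry j)) ⟩
    Σ≤ (n ℕ.+ n) (λ j → Eₖ j * cA1 g f n j)
      ≡⟨ Σ≤-truncate (ℕₚ.m≤m+n n n) (λ j n<j _ → trans (cong (Eₖ j *_) (cA1-lowerTriangular n<j)) (ℤₚ.*-zeroʳ (Eₖ j))) ⟩
    Σ≤ n (λ j → Eₖ j * cA1 g f n j)
      ≡⟨ Σ≤-cong n (λ j _ → ℤₚ.*-comm (Eₖ j) (cA1 g f n j)) ⟩
    (cA1 g f ·ₘ riordan E h) n k ∎)
    where
      open ≡-Reasoning
      Eₖ : Series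
      Eₖ = E ⊛ pow h k
      entry : ∀ j → ((g ⊛ pow v n) ⊛ pow v j) (n ℕ.+ n) ≡ cA1 g f n j
      entry j = trans (⊛-assoc g (pow v n) (pow v j) (n ℕ.+ n)) (⊛-congˡ g (pow-+ v n j) (n ℕ.+ n))

module Inverse (g f : Series) (f0 : f 0 ≡ 1ℤ)
    (finv : Series) (f⊛finv : f ⊛ finv ≗ one)
    (φ : Series) (φ0 : φ 0 ≡ 0ℤ) (ψ∘φ : (X ⊛ finv) ∘ₛ φ ≗ X)
    (vbar : Series) (vbar0 : vbar 0 ≡ 0ℤ) (v∘vbar : (X ⊛ f) ∘ₛ vbar ≗ X)
    (w : Series) (f∘vbar⊛w : (f ∘ₛ vbar) ⊛ w ≗ one)
    (p : Series) (g∘vbar⊛p : (g ∘ₛ vbar) ⊛ p ≗ one)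
    (q : Series) (φ′∘h⊛q : (deriv φ ∘ₛ (vbar ⊛ w)) ⊛ q ≗ one) where

  v ψ h D : Series
  v = X ⊛ f
  ψ = X ⊛ finv
  h = vbar ⊛ w
  D = p ⊛ (f ∘ₛ vbar) ⊛ q

  h0 : h 0 ≡ 0ℤ
  h0 = trans (cong (_* w 0) vbar0) (ℤₚ.*-zeroˡ (w 0))

  private
    vbar∘v : vbar ∘ₛ v ≗ X
    vbar∘v = ∘ₛ-inverseʳ⇒inverseˡ v vbar refl (trans (X⊛-suc f 0) f0) vbar0 v∘vbar

    φ∘ψ : φ ∘ₛ ψ ≗ X
    φ∘ψ = ∘ₛ-inverseʳ⇒inverseˡ ψ φ refl (trans (X⊛-suc finv 0) (⊛-inverse-constant f finv f0 f⊛finv)) φ0 ψ∘φ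

    ∘vbar∘v : ∀ c → (c ∘ₛ vbar) ∘ₛ v ≗ c
    ∘vbar∘v c = begin
      (c ∘ₛ vbar) ∘ₛ v  ≈⟨ ∘ₛ-assoc c vbar v vbar0 refl ⟩
      c ∘ₛ (vbar ∘ₛ v)  ≈⟨ ∘ₛ-congˡ c vbar∘v ⟩
      c ∘ₛ X            ≈⟨ ∘ₛ-X c ⟩
      c                 ∎
      where open ≗-Reasoning

    ∘v-distrib-⊛ : ∀ a b → (a ⊛ b) ∘ₛ v ≗ (a ∘ₛ v) ⊛ (b ∘ₛ v)
    ∘v-distrib-⊛ a b = ∘ₛ-distrib-⊛ a b v refl

    inverse-∘v : ∀ c e → c ⊛ e ≗ one → (c ∘ₛ v) ⊛ (e ∘ₛ v) ≗ one
    inverse-∘v c e ce≗1 = begin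
      (c ∘ₛ v) ⊛ (e ∘ₛ v)  ≈⟨ ∘v-distrib-⊛ c e ⟨
      (c ⊛ e) ∘ₛ v         ≈⟨ ∘ₛ-congʳ v ce≗1 ⟩
      one ∘ₛ v             ≈⟨ one-∘ₛ v ⟩
      one                  ∎
      where open ≗-Reasoning

    w∘v : w ∘ₛ v ≗ finv
    w∘v = ⊛-inverse-unique f (w ∘ₛ v) finv
            (λ n → trans (⊛-congʳ (w ∘ₛ v) (sym ∘ ∘vbar∘v f) n) (inverse-∘v (f ∘ₛ vbar) w f∘vbar⊛w n)) f⊛finv

    g⊛p∘v : g ⊛ (p ∘ₛ v) ≗ one
    g⊛p∘v n = trans (⊛-congʳ (p ∘ₛ v) (sym ∘ ∘vbar∘v g) n) (inverse-∘v (g ∘ₛ vbar) p g∘vbar⊛p n)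

    h∘v : h ∘ₛ v ≗ ψ
    h∘v = begin
      (vbar ⊛ w) ∘ₛ v          ≈⟨ ∘v-distrib-⊛ vbar w ⟩
      (vbar ∘ₛ v) ⊛ (w ∘ₛ v)   ≈⟨ ⊛-cong vbar∘v w∘v ⟩
      X ⊛ finv                 ∎
      where open ≗-Reasoning

    φ′∘ψ⊛ψ′ : (deriv φ ∘ₛ ψ) ⊛ deriv ψ ≗ one
    φ′∘ψ⊛ψ′ = begin
      (deriv φ ∘ₛ ψ) ⊛ deriv ψ  ≈⟨ deriv-∘ₛ φ ψ refl ⟨
      deriv (φ ∘ₛ ψ)            ≈⟨ deriv-cong φ∘ψ ⟩
      deriv X                   ≈⟨ deriv-X ⟩
      one                       ∎
      where open ≗-Reasoning

    q∘v : q ∘ₛ v ≗ deriv ψ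
    q∘v = ⊛-inverse-unique (deriv φ ∘ₛ ψ) (q ∘ₛ v) (deriv ψ) (begin
      (deriv φ ∘ₛ ψ) ⊛ (q ∘ₛ v)                ≈⟨ ⊛-congʳ (q ∘ₛ v) (∘ₛ-congˡ (deriv φ) h∘v) ⟨
      (deriv φ ∘ₛ (h ∘ₛ v)) ⊛ (q ∘ₛ v)         ≈⟨ ⊛-congʳ (q ∘ₛ v) (∘ₛ-assoc (deriv φ) h v h0 refl) ⟨
      ((deriv φ ∘ₛ h) ∘ₛ v) ⊛ (q ∘ₛ v)         ≈⟨ inverse-∘v (deriv φ ∘ₛ h) q φ′∘h⊛q ⟩
      one                                      ∎) φ′∘ψ⊛ψ′
      where open ≗-Reasoning

    column∘v : ∀ k → (D ⊛ pow h k) ∘ₛ v ≗ ((p ∘ₛ v) ⊛ f ⊛ deriv ψ) ⊛ (pow X k ⊛ pow finv k)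
    column∘v k = begin
      (D ⊛ pow h k) ∘ₛ v                                          ≈⟨ ∘v-distrib-⊛ D (pow h k) ⟩
      (D ∘ₛ v) ⊛ (pow h k ∘ₛ v)                                   ≈⟨ ⊛-cong (∘v-distrib-⊛ (p ⊛ (f ∘ₛ vbar)) q)
                                                                                (sym ∘ pow-∘ₛ h v refl k) ⟩
      ((p ⊛ (f ∘ₛ vbar)) ∘ₛ v ⊛ q ∘ₛ v) ⊛ pow (h ∘ₛ v) k           ≈⟨ ⊛-cong (⊛-cong (∘v-distrib-⊛ p (f ∘ₛ vbar)) q∘v)
                                                                                (pow-cong k h∘v) ⟩
      ((p ∘ₛ v) ⊛ ((f ∘ₛ vbar) ∘ₛ v) ⊛ deriv ψ) ⊛ pow (X ⊛ finv) k ≈⟨ ⊛-cong (⊛-congʳ (deriv ψ) (⊛-congˡ (p ∘ₛ v) (∘vbar∘v f)))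
                                                                                (pow-⊛ X finv k) ⟩
      ((p ∘ₛ v) ⊛ f ⊛ deriv ψ) ⊛ (pow X k ⊛ pow finv k)           ∎
      where open ≗-Reasoning

    T : ℕ → ℕ → Series
    T n k = (pow f n ⊛ pow finv k) ⊛ (f ⊛ deriv ψ)

    substituted : ∀ n k → (g ⊛ pow v n) ⊛ ((D ⊛ pow h k) ∘ₛ v) ≗ pow X (n ℕ.+ k) ⊛ T n k
    substituted n k = begin
      (g ⊛ pow v n) ⊛ ((D ⊛ pow h k) ∘ₛ v)
        ≈⟨ ⊛-cong (⊛-congˡ g (pow-⊛ X f n)) (column∘v k) ⟩
      (g ⊛ (pow X n ⊛ pow f n)) ⊛ (((p ∘ₛ v) ⊛ f ⊛ deriv ψ) ⊛ (pow X k ⊛ pow finv k))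
        ≈⟨ regroup g (pow X n) (pow f n) (p ∘ₛ v) f (deriv ψ) (pow X k) (pow finv k) ⟩
      (g ⊛ (p ∘ₛ v)) ⊛ ((pow X n ⊛ pow X k) ⊛ T n k)
        ≈⟨ ⊛-cong g⊛p∘v (⊛-congʳ (T n k) (pow-+ X n k)) ⟩
      one ⊛ (pow X (n ℕ.+ k) ⊛ T n k)
        ≈⟨ ⊛-identityˡ _ ⟩
      pow X (n ℕ.+ k) ⊛ T n k ∎
      where
        open ≗-Reasoning
        regroup : ∀ G Xn Fn P F Q Xk Ik → (G ⊛ (Xn ⊛ Fn)) ⊛ ((P ⊛ F ⊛ Q) ⊛ (Xk ⊛ Ik)) ≗ (G ⊛ P) ⊛ ((Xn ⊛ Xk) ⊛ ((Fn ⊛ Ik) ⊛ (F ⊛ Q)))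
        regroup = solve 8 (λ G Xn Fn P F Q Xk Ik → (G ∙ (Xn ∙ Fn)) ∙ (((P ∙ F) ∙ Q) ∙ (Xk ∙ Ik))
                                                  ⊜ (G ∙ P) ∙ ((Xn ∙ Xk) ∙ ((Fn ∙ Ik) ∙ (F ∙ Q)))) (λ _ → refl)

    T-reduce : ∀ k m → T (k ℕ.+ m) k ≗ pow f (suc m) ⊛ deriv ψ
    T-reduce k m = begin
      (pow f (k ℕ.+ m) ⊛ pow finv k) ⊛ (f ⊛ deriv ψ)       ≈⟨ ⊛-congʳ (f ⊛ deriv ψ) (⊛-congʳ (pow finv k) (pow-+ f k m)) ⟨
      ((pow f k ⊛ pow f m) ⊛ pow finv k) ⊛ (f ⊛ deriv ψ)    ≈⟨ regroup (pow f k) (pow f m) (pow finv k) f (deriv ψ) ⟩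
      (pow f k ⊛ pow finv k) ⊛ (f ⊛ pow f m ⊛ deriv ψ)     ≈⟨ ⊛-congʳ (pow f (suc m) ⊛ deriv ψ) f^k⊛finv^k≗1 ⟩
      one ⊛ (pow f (suc m) ⊛ deriv ψ)                      ≈⟨ ⊛-identityˡ _ ⟩
      pow f (suc m) ⊛ deriv ψ                              ∎
      where
        open ≗-Reasoning
        regroup : ∀ Fk Fm Ik F Q → ((Fk ⊛ Fm) ⊛ Ik) ⊛ (F ⊛ Q) ≗ (Fk ⊛ Ik) ⊛ (F ⊛ Fm ⊛ Q)
        regroup = solve 5 (λ Fk Fm Ik F Q → ((Fk ∙ Fm) ∙ Ik) ∙ (F ∙ Q) ⊜ (Fk ∙ Ik) ∙ ((F ∙ Fm) ∙ Q)) (λ _ → refl)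
        f^k⊛finv^k≗1 : pow f k ⊛ pow finv k ≗ one
        f^k⊛finv^k≗1 = begin
          pow f k ⊛ pow finv k  ≈⟨ pow-⊛ f finv k ⟨
          pow (f ⊛ finv) k      ≈⟨ pow-cong k f⊛finv ⟩
          pow one k             ≈⟨ pow-one k ⟩
          one                   ∎

    coefficient : ∀ n k → k ≤ n ⊎ n < k → (pow X (n ℕ.+ k) ⊛ T n k) (n ℕ.+ n) ≡ idM n k
    coefficient n k (inj₂ n<k) =
      trans (pow-X⊛-below (n ℕ.+ k) (T n k) (n ℕ.+ n) (ℕₚ.+-monoʳ-< n n<k)) (sym (idM-offDiagonal (ℕₚ.<⇒≢ n<k)))
    coefficient n k (inj₁ k≤n) with ℕₚ.m≤n⇒∃[o]m+o≡n k≤n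
    ... | m , refl = begin
      (pow X (n ℕ.+ k) ⊛ T n k) (n ℕ.+ n)        ≡⟨ cong (pow X (n ℕ.+ k) ⊛ T n k) (ℕₚ.+-assoc n k m) ⟨
      (pow X (n ℕ.+ k) ⊛ T n k) (n ℕ.+ k ℕ.+ m)  ≡⟨ pow-X⊛-shift (n ℕ.+ k) (T n k) m ⟩
      T n k m                                    ≡⟨ T-reduce k m m ⟩
      (pow f (suc m) ⊛ deriv ψ) m                ≡⟨ pow⊛ψ′-coeff f finv f0 f⊛finv m ⟩
      idM m 0                                    ≡⟨ idM-shift k m ⟨
      idM n k                                    ∎
      where open ≡-Reasoning

  C·R≡I : ∀ n k → (cA1 g f ·ₘ riordan D h) n k ≡ idM n k
  C·R≡I n k = begin
    (cA1 g f ·ₘ riordan D h) n k                           ≡⟨ cA1-·ₘ-riordan g f D h n k ⟩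
    ((g ⊛ pow v n) ⊛ ((D ⊛ pow h k) ∘ₛ v)) (n ℕ.+ n)       ≡⟨ substituted n k (n ℕ.+ n) ⟩
    (pow X (n ℕ.+ k) ⊛ T n k) (n ℕ.+ n)                    ≡⟨ coefficient n k (ℕₚ.≤-<-connex k n) ⟩
    idM n k                                                ∎
    where open ≡-Reasoning

mainTheorem4 : (g f : Series) → g 0 ≡ 1ℤ → f 0 ≡ 1ℤ →
    (finv : Series) → f ⊛ finv ≗ one →
    (φ : Series) → φ 0 ≡ 0ℤ → (X ⊛ finv) ∘ₛ φ ≗ X →
    (vbar : Series) → vbar 0 ≡ 0ℤ → (X ⊛ f) ∘ₛ vbar ≗ X →
    (w : Series) → (f ∘ₛ vbar) ⊛ w ≗ one →
    (p : Series) → (g ∘ₛ vbar) ⊛ p ≗ one →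
    (q : Series) → (deriv φ ∘ₛ (vbar ⊛ w)) ⊛ q ≗ one →
    ((n k : ℕ) → (riordan (p ⊛ (f ∘ₛ vbar) ⊛ q) (vbar ⊛ w) ·ₘ cA1 g f) n k ≡ idM n k)
    × ((n k : ℕ) → (cA1 g f ·ₘ riordan (p ⊛ (f ∘ₛ vbar) ⊛ q) (vbar ⊛ w)) n k ≡ idM n k)
mainTheorem4 g f g0 f0 finv f⊛finv φ φ0 ψ∘φ vbar vbar0 v∘vbar w f∘vbar⊛w p g∘vbar⊛p q φ′∘h⊛q =
  inverseʳ⇒inverseˡ (cA1-lowerTriangular g f) (riordan-lowerTriangular D h0) (cA1-diagonal g f g0 f0) C·R≡I , C·R≡I
  where open Inverse g f f0 finv f⊛finv φ φ0 ψ∘φ vbar vbar0 v∘vbar w f∘vbar⊛w p g∘vbar⊛p q φ′∘h⊛q
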